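{- Let $b \geq 3$ and $e \geq 0$ be integers and let $q(x) = b^x + 2x$. For each $c_e \in \{0,1,\dots,b-1\}$, the graph $G_b(q(e),e)$ contains a path $P$ of length $1 + c_e b^e$ from the vertex $q(e)$ to the vertex $q(e+1)$ such that $P$ contains exactly one base chord.
   Context: For integers $b \geq 3$, $i \geq 1$, $e \geq 0$, the graph $G_b(i,e)$ has vertex set $\{i, i+1, \dots, i+2+b^{e+1}-b^e\}$ and edge set $\{\{j,j+1\} : i \leq j \leq i+1+b^{e+1}-b^e\} \cup \{\{i, i+2+jb^e\} : 0 \leq j \leq b-1\}$. The edges $\{i, i+2+jb^e\}$, $0 \leq j \leq b-1$, are called the base chords of $G_b(i,e)$. (Note that the last vertex of $G_b(q(e),e)$ is $q(e+1)$.) -}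

module Defs where

open import Data.Nat using (ℕ; zero; suc; _+_; _*_; _∸_; _^_; _≤_; _<_)
open import Data.Product using (_×_; _,_; ∃-syntax)
open import Data.Sum using (_⊎_)
open import Data.List using (List; []; _∷_; length)
open import Data.List.Relation.Unary.All using (All)
open import Data.List.Relation.Unary.Unique.Propositional using (Unique)
open import Data.Fin using (Fin; toℕ)
open import Relation.Binary.PropositionalEquality using (_≡_; _≢_)
open import Relation.Nullary using (¬_)

q : ℕ → ℕ → ℕ
q b x = b ^ x + 2 * x

lastV : ℕ → ℕ → ℕ → ℕ
lastV b i e = i + 2 + (b ^ suc e ∸ b ^ e)

IsVertex : ℕ → ℕ → ℕ → ℕ → Set
IsVertex b i e v = i ≤ v × v ≤ lastV b i e

BaseChordOrd : ℕ → ℕ → ℕ → ℕ → ℕ → Set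
BaseChordOrd b i e u v = u ≡ i × ∃[ j ] (j < b × v ≡ i + 2 + j * b ^ e)

IsBaseChord : ℕ → ℕ → ℕ → ℕ → ℕ → Set
IsBaseChord b i e u v = BaseChordOrd b i e u v ⊎ BaseChordOrd b i e v u

PathEdgeOrd : ℕ → ℕ → ℕ → ℕ → ℕ → Set
PathEdgeOrd b i e u v = i ≤ u × suc u ≤ lastV b i e × v ≡ suc u

IsEdge : ℕ → ℕ → ℕ → ℕ → ℕ → Set
IsEdge b i e u v = PathEdgeOrd b i e u v ⊎ PathEdgeOrd b i e v u ⊎ IsBaseChord b i e u v

steps : List ℕ → List (ℕ × ℕ)
steps [] = []
steps (x ∷ []) = []
steps (x ∷ y ∷ xs) = (x , y) ∷ steps (y ∷ xs)

AllEdges : ℕ → ℕ → ℕ → List ℕ → Set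
AllEdges b i e xs = All (λ p → IsEdge b i e (Data.Product.proj₁ p) (Data.Product.proj₂ p)) (steps xs)

record IsPath (b i e s t : ℕ) (P : List ℕ) : Set where
  field
    starts   : ∃[ rest ] (P ≡ s ∷ rest)
    ends     : ∃[ init ] (P ≡ init Data.List.++ (t ∷ []))
    vertices : All (IsVertex b i e) P
    distinct : Unique P
    adjacent : AllEdges b i e P

pathLength : List ℕ → ℕ
pathLength P = length (steps P)

stepAt : (P : List ℕ) → Fin (length (steps P)) → ℕ × ℕ
stepAt P k = Data.List.lookup (steps P) k

-- P contains exactly one base chord of G_b(i,e) among its edges
-- (edges of a path are distinct, so counting positions = counting edges)
ExactlyOneBaseChord : ℕ → ℕ → ℕ → List ℕ → Set
ExactlyOneBaseChord b i e P =
  ∃[ k ] (IsBaseChord b i e (Data.Product.proj₁ (stepAt P k)) (Data.Product.proj₂ (stepAt P k))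
         × (∀ k′ → k′ ≢ k → ¬ IsBaseChord b i e (Data.Product.proj₁ (stepAt P k′)) (Data.Product.proj₂ (stepAt P k′))))

-- Use the base chord from q(e) to q(e) + 2 + (b − 1 − c)·bᵉ and then walk along the
-- spine up to the last vertex q(e+1), which is c·bᵉ spine edges further. Every base
-- chord is incident to q(e), while the walk stays strictly above q(e), so the first
-- edge is the only base chord on the path.
module Submission where

open import Defs
open import Data.Nat using (ℕ; _+_; _*_; _^_; _≤_; _<_; suc; zero; _∸_; s≤s; z≤n)
open import Data.Nat.Properties
open import Data.Nat.Tactic.RingSolver using (solve-∀)
open import Data.List using ([]; _∷_; _++_; [_]; length; iterate)
open import Data.List.Properties using (length-iterate)
open import Data.List.Membership.Propositional using (_∈_)
open import Data.List.Membership.Propositional.Properties using (∈-lookup)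
open import Data.List.Relation.Unary.Any using (here; there)
open import Data.List.Relation.Unary.All as All using (All; []; _∷_)
open import Data.List.Relation.Unary.Unique.Propositional using (Unique)
open import Data.List.Relation.Unary.AllPairs using ([]; _∷_)
open import Data.Product using (_×_; ∃-syntax; _,_; proj₁; proj₂)
open import Data.Sum using (_⊎_; inj₁; inj₂)
open import Data.Fin using (zero; suc)
open import Data.Empty using (⊥-elim)
open import Relation.Binary.PropositionalEquality using (_≡_; refl; sym; trans; cong; subst; module ≡-Reasoning)
open import Relation.Nullary using (¬_)

length-steps : ∀ x xs → length (steps (x ∷ xs)) ≡ length xs
length-steps x [] = refl
length-steps x (y ∷ xs) = cong suc (length-steps y xs)

steps-⊆ : ∀ xs → All (λ p → proj₁ p ∈ xs × proj₂ p ∈ xs) (steps xs)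
steps-⊆ [] = []
steps-⊆ (x ∷ []) = []
steps-⊆ (x ∷ y ∷ xs) =
  (here refl , there (here refl)) ∷ All.map (λ (u∈ , v∈) → there u∈ , there v∈) (steps-⊆ (y ∷ xs))

steps-iterate : ∀ f x n → All (λ p → proj₂ p ≡ f (proj₁ p)) (steps (iterate f x n))
steps-iterate f x zero = []
steps-iterate f x (suc zero) = []
steps-iterate f x (suc (suc n)) = refl ∷ steps-iterate f (f x) (suc n)

∈-iterate-suc : ∀ {a n x} → x ∈ iterate suc a n → a ≤ x × x < a + n
∈-iterate-suc {a} {suc n} (here refl) = ≤-refl , m<m+n a (s≤s z≤n)
∈-iterate-suc {a} {suc n} (there x∈) with ∈-iterate-suc x∈
... | a<x , x<1+a+n = <⇒≤ a<x , ≤-trans x<1+a+n (≤-reflexive (sym (+-suc a n)))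

iterate-suc-unique : ∀ a n → Unique (iterate suc a n)
iterate-suc-unique a zero = []
iterate-suc-unique a (suc n) =
  All.tabulate (λ x∈ → <⇒≢ (proj₁ (∈-iterate-suc x∈))) ∷ iterate-suc-unique (suc a) n

iterate-suc-last : ∀ a n → iterate suc a (suc n) ≡ iterate suc a n ++ [ a + n ]
iterate-suc-last a zero = cong [_] (sym (+-identityʳ a))
iterate-suc-last a (suc n) =
  cong (a ∷_) (trans (iterate-suc-last (suc a) n) (cong (λ x → iterate suc (suc a) n ++ [ x ]) (sym (+-suc a n))))

baseChord-incident : ∀ {b i e u v} → IsBaseChord b i e u v → u ≡ i ⊎ v ≡ i
baseChord-incident (inj₁ (u≡i , _)) = inj₁ u≡i
baseChord-incident (inj₂ (v≡i , _)) = inj₂ v≡i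

¬baseChord-above : ∀ {b i e u v} → i < u → i < v → ¬ IsBaseChord b i e u v
¬baseChord-above {e = e} i<u i<v chord with baseChord-incident {e = e} chord
... | inj₁ refl = <-irrefl refl i<u
... | inj₂ refl = <-irrefl refl i<v

exactlyOne-first : ∀ {b i e x y ys} → IsBaseChord b i e x y →
  All (λ p → ¬ IsBaseChord b i e (proj₁ p) (proj₂ p)) (steps (y ∷ ys)) →
  ExactlyOneBaseChord b i e (x ∷ y ∷ ys)
exactlyOne-first chord noChords = zero , chord , λ
  { zero 0≢0 → ⊥-elim (0≢0 refl)
  ; (suc k) _ → All.lookup noChords (∈-lookup k)
  }

module _ {b i e a : ℕ} (chord : BaseChordOrd b i e i a) where

  i<a : i < a
  i<a = let (_ , j , _ , a≡) = chord in
    <-≤-trans (m<m+n i (s≤s z≤n)) (≤-trans (m≤m+n (i + 2) (j * b ^ e)) (≤-reflexive (sym a≡)))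

  above-base : ∀ {n x} → x ∈ iterate suc a n → i < x
  above-base x∈ = <-≤-trans i<a (proj₁ (∈-iterate-suc x∈))

  jump-path : ∀ n → a + n ≤ lastV b i e → IsPath b i e i (a + n) (i ∷ iterate suc a (suc n))
  jump-path n a+n≤last = record
    { starts   = _ , refl
    ; ends     = i ∷ iterate suc a n , cong (i ∷_) (iterate-suc-last a n)
    ; vertices = (≤-refl , ≤-trans (<⇒≤ i<a) (≤-trans (m≤m+n a n) a+n≤last))
               ∷ All.tabulate (λ x∈ → <⇒≤ (above-base x∈) , below-last x∈)
    ; distinct = All.tabulate (λ x∈ → <⇒≢ (above-base x∈)) ∷ iterate-suc-unique a (suc n)
    ; adjacent = inj₂ (inj₂ (inj₁ chord))
               ∷ All.zipWith spine-edge (steps-iterate suc a (suc n) , steps-⊆ (iterate suc a (suc n)))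
    }
    where
    below-last : ∀ {x} → x ∈ iterate suc a (suc n) → x ≤ lastV b i e
    below-last x∈ = ≤-trans (≤-pred (≤-trans (proj₂ (∈-iterate-suc x∈)) (≤-reflexive (+-suc a n)))) a+n≤last

    spine-edge : ∀ {p} → (proj₂ p ≡ suc (proj₁ p)) × (proj₁ p ∈ iterate suc a (suc n) × proj₂ p ∈ iterate suc a (suc n)) →
      IsEdge b i e (proj₁ p) (proj₂ p)
    spine-edge (v≡1+u , u∈ , v∈) = inj₁ (<⇒≤ (above-base u∈) , subst (_≤ lastV b i e) v≡1+u (below-last v∈) , v≡1+u)

  jump-exactlyOne : ∀ n → ExactlyOneBaseChord b i e (i ∷ iterate suc a (suc n))
  jump-exactlyOne n = exactlyOne-first {e = e} (inj₁ chord)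
    (All.map (λ (u∈ , v∈) → ¬baseChord-above {e = e} (above-base u∈) (above-base v∈)) (steps-⊆ (iterate suc a (suc n))))

lastV-suc : ∀ b′ i e → lastV (suc b′) i e ≡ i + 2 + b′ * suc b′ ^ e
lastV-suc b′ i e = cong (i + 2 +_) (m+n∸m≡n (suc b′ ^ e) (b′ * suc b′ ^ e))

q-suc : ∀ b′ e → q (suc b′) (suc e) ≡ q (suc b′) e + 2 + b′ * suc b′ ^ e
q-suc b′ e = identity (suc b′ ^ e) b′ e
  where
  identity : ∀ B b′ e → B + b′ * B + 2 * suc e ≡ B + 2 * e + 2 + b′ * B
  identity = solve-∀

m+[n∸o]*k+o*k≡m+n*k : ∀ m n o k → o ≤ n → m + (n ∸ o) * k + o * k ≡ m + n * k
m+[n∸o]*k+o*k≡m+n*k m n o k o≤n = begin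
  m + (n ∸ o) * k + o * k   ≡⟨ +-assoc m _ _ ⟩
  m + ((n ∸ o) * k + o * k) ≡⟨ cong (m +_) (sym (*-distribʳ-+ k (n ∸ o) o)) ⟩
  m + (n ∸ o + o) * k       ≡⟨ cong (λ x → m + x * k) (m∸n+n≡m o≤n) ⟩
  m + n * k                 ∎
  where open ≡-Reasoning

-- Only b ≥ 1 (forced by c < b) is needed.
lemma3 : (b e : ℕ) → 3 ≤ b → (c : ℕ) → c < b →
    ∃[ P ] (IsPath b (q b e) e (q b e) (q b (suc e)) P
    × pathLength P ≡ 1 + c * b ^ e
    × ExactlyOneBaseChord b (q b e) e P)
lemma3 (suc b′) e _ c (s≤s c≤b′) =
  subst (λ t → ∃[ P ] (IsPath b i e i t P × pathLength P ≡ 1 + c * B × ExactlyOneBaseChord b i e P))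
    (trans walk-end (sym (q-suc b′ e)))
    ( i ∷ iterate suc a (suc (c * B))
    , jump-path {e = e} chord (c * B) (≤-reflexive (trans walk-end (sym (lastV-suc b′ i e))))
    , trans (length-steps i (iterate suc a (suc (c * B)))) (length-iterate suc a (suc (c * B)))
    , jump-exactlyOne {e = e} chord (c * B)
    )
  where
  b = suc b′
  B = b ^ e
  i = q b e
  a = i + 2 + (b′ ∸ c) * B

  chord : BaseChordOrd b i e i a
  chord = refl , b′ ∸ c , s≤s (m∸n≤m b′ c) , refl

  walk-end : a + c * B ≡ i + 2 + b′ * B
  walk-end = m+[n∸o]*k+o*k≡m+n*k (i + 2) b′ c B c≤b′
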